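{- Let $(c_n)_{n\ge0}$ be determined by $c_0=1$ and $\sum_{k=0}^{N}\frac{c_k}{N+k+1}=0$ for $N\ge1$. Set $a_n=c_{n-1}$ for $n\ge1$, $g(t)=2/(1+t)$ and $A_g(x)=\sum_{n\le x}a_n\,g(n/x)$ for $x\ge1$. Then for every integer $N\ge2$, $$A_g(N)=-\frac{2N}{2N+1}\,a_{N+1}.$$ -}

module Defs where

open import Data.Nat as ℕ using (ℕ; zero; suc; _∸_)
open import Data.Integer using (+_)
open import Data.Rational using (ℚ; 0ℚ; 1ℚ; _+_; _*_; _/_; 1/_; ≢-nonZero)
open import Data.Rational.Properties using (_≟_)
open import Relation.Nullary using (yes; no)

sumTo : ℕ → (ℕ → ℚ) → ℚ
sumTo zero    f = 0ℚ
sumTo (suc n) f = sumTo n f + f n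

-- total reciprocal: coincides with 1/_ on nonzero arguments (0 ↦ 0)
inv : ℚ → ℚ
inv p with p ≟ 0ℚ
... | yes _  = 0ℚ
... | no p≢0 = (1/ p) {{≢-nonZero p≢0}}

-- g(t) = 2/(1+t)  (only evaluated at t ≥ 0, where 1 + t ≠ 0)
g : ℚ → ℚ
g t = (+ 2 / 1) * inv (1ℚ + t)

aSeq : (ℕ → ℚ) → ℕ → ℚ
aSeq c n = c (n ∸ 1)

-- A_g(N) = Σ_{1 ≤ n ≤ N} a_n g(n/N), for N ≥ 1 (written with N = suc M)
A_g : (ℕ → ℚ) → (M : ℕ) → ℚ
A_g c M = sumTo (suc M) (λ i → aSeq c (suc i) * g ((+ suc i) / suc M))

recSum : (ℕ → ℚ) → ℕ → ℚ
recSum c N = sumTo (suc N) (λ k → c k * ((+ 1) / suc (N ℕ.+ k)))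

{-# OPTIONS --safe #-}
module Submission where

-- Since g(n/N) = 2N/(N+n), the N summands of A_g(N) are 2N times the first N terms of the
-- recurrence sum for index N; the recurrence makes those terms equal to minus the last one,
-- c_N/(2N+1) = a_{N+1}/(2N+1).

open import Defs
open import Data.Nat as ℕ using (ℕ; zero; suc; _+_; _*_; _≥_; _∸_; s≤s; z≤n)
import Data.Nat.Properties as ℕₚ
open import Data.Integer as ℤ using (+_)
open import Data.Integer.Properties using (pos-*)
open import Data.Integer.Solver using (module +-*-Solver)
open import Data.Rational using (ℚ; 0ℚ; 1ℚ; _/_; -_; 1/_; ≢-nonZero; toℚᵘ)
  renaming (_+_ to _+ℚ_; _*_ to _*ℚ_)
open import Data.Rational.Properties
  using (_≟_; 1≢0; *-assoc; *-identityˡ; *-identityʳ; *-zeroˡ; *-zeroʳ; *-inverseˡ; *-distribˡ-+;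
         neg-distribˡ-*; +-0-group; +-*-commutativeRing;
         toℚᵘ-injective; toℚᵘ-fromℚᵘ; toℚᵘ-homo-+; toℚᵘ-homo-*)
open import Data.Rational.Unnormalised as ℚᵘ using (mkℚᵘ; *≡*; _≃_)
import Data.Rational.Unnormalised.Properties as ℚᵘ
open import Algebra.Bundles using (CommutativeRing)
open import Algebra.Properties.Group +-0-group using (inverseˡ-unique)
open import Algebra.Properties.CommutativeSemigroup
  (CommutativeRing.*-commutativeSemigroup +-*-commutativeRing) using (x∙yz≈y∙xz; xy∙z≈x∙zy)
open import Relation.Binary.PropositionalEquality using (_≡_; refl; sym; trans; cong; cong₂; module ≡-Reasoning)
open import Relation.Nullary using (yes; no)
open import Data.Empty using (⊥-elim)
open ≡-Reasoning

sumTo-cong : ∀ n {f h : ℕ → ℚ} → (∀ i → f i ≡ h i) → sumTo n f ≡ sumTo n h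
sumTo-cong zero    f≗h = refl
sumTo-cong (suc n) f≗h = cong₂ _+ℚ_ (sumTo-cong n f≗h) (f≗h n)

sumTo-*ˡ : ∀ n s (f : ℕ → ℚ) → sumTo n (λ i → s *ℚ f i) ≡ s *ℚ sumTo n f
sumTo-*ˡ zero    s f = sym (*-zeroʳ s)
sumTo-*ˡ (suc n) s f = begin
  sumTo n (λ i → s *ℚ f i) +ℚ s *ℚ f n ≡⟨ cong (_+ℚ s *ℚ f n) (sumTo-*ˡ n s f) ⟩
  s *ℚ sumTo n f +ℚ s *ℚ f n           ≡⟨ *-distribˡ-+ s (sumTo n f) (f n) ⟨
  s *ℚ (sumTo n f +ℚ f n)              ∎

inv-unique : ∀ p q → p *ℚ q ≡ 1ℚ → inv p ≡ q
inv-unique p q pq≡1 with p ≟ 0ℚ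
... | yes refl = ⊥-elim (1≢0 (trans (sym pq≡1) (*-zeroˡ q)))
... | no p≢0   = begin
  p⁻¹                  ≡⟨ *-identityʳ p⁻¹ ⟨
  p⁻¹ *ℚ 1ℚ            ≡⟨ cong (p⁻¹ *ℚ_) pq≡1 ⟨
  p⁻¹ *ℚ (p *ℚ q)      ≡⟨ *-assoc p⁻¹ p q ⟨
  (p⁻¹ *ℚ p) *ℚ q      ≡⟨ cong (_*ℚ q) (*-inverseˡ p {{≢-nonZero p≢0}}) ⟩
  1ℚ *ℚ q              ≡⟨ *-identityˡ q ⟩
  q                    ∎
  where p⁻¹ = (1/ p) {{≢-nonZero p≢0}}

-- Identities between fractions are checked in ℚᵘ, where a/(b+1) is the unnormalised mkℚᵘ a b
-- and equality is cross-multiplication in ℤ.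
toℚᵘ-/ : ∀ a b → toℚᵘ ((+ a) / suc b) ≃ mkℚᵘ (+ a) b
toℚᵘ-/ a b = toℚᵘ-fromℚᵘ (mkℚᵘ (+ a) b)

toℚᵘ-*-≃ : ∀ {p q p′ q′} → toℚᵘ p ≃ p′ → toℚᵘ q ≃ q′ → toℚᵘ (p *ℚ q) ≃ p′ ℚᵘ.* q′
toℚᵘ-*-≃ {p} {q} p≃ q≃ = ℚᵘ.≃-trans (toℚᵘ-homo-* p q) (ℚᵘ.*-cong p≃ q≃)

toℚᵘ-+-≃ : ∀ {p q p′ q′} → toℚᵘ p ≃ p′ → toℚᵘ q ≃ q′ → toℚᵘ (p +ℚ q) ≃ p′ ℚᵘ.+ q′
toℚᵘ-+-≃ {p} {q} p≃ q≃ = ℚᵘ.≃-trans (toℚᵘ-homo-+ p q) (ℚᵘ.+-cong p≃ q≃)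

open +-*-Solver using (solve; _:+_; _:*_; _:=_; con)

/1-*-/ : ∀ a b d → ((+ a) / 1) *ℚ ((+ b) / suc d) ≡ (+ (a * b)) / suc d
/1-*-/ a b d = toℚᵘ-injective (ℚᵘ.≃-trans (toℚᵘ-*-≃ (toℚᵘ-/ a 0) (toℚᵘ-/ b d))
  (ℚᵘ.≃-sym (ℚᵘ.≃-trans (toℚᵘ-/ (a * b) d) (*≡* (begin
    + (a * b) ℤ.* (+ 1 ℤ.* + suc d)     ≡⟨ cong (ℤ._* (+ 1 ℤ.* + suc d)) (pos-* a b) ⟩
    (+ a ℤ.* + b) ℤ.* (+ 1 ℤ.* + suc d) ≡⟨ solve 3 (λ x y z → (x :* y) :* (con (+ 1) :* z) := (x :* y) :* z)
                                                   refl (+ a) (+ b) (+ suc d) ⟩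
    (+ a ℤ.* + b) ℤ.* + suc d           ∎)))))

/-split : ∀ a b → (+ a) / suc b ≡ ((+ a) / 1) *ℚ ((+ 1) / suc b)
/-split a b = begin
  (+ a) / suc b                     ≡⟨ cong (λ k → (+ k) / suc b) (ℕₚ.*-identityʳ a) ⟨
  (+ (a * 1)) / suc b               ≡⟨ /1-*-/ a 1 b ⟨
  ((+ a) / 1) *ℚ ((+ 1) / suc b)    ∎

inv-1+/ : ∀ m n → inv (1ℚ +ℚ (+ n) / suc m) ≡ (+ suc m) / suc (m + n)
inv-1+/ m n = inv-unique (1ℚ +ℚ (+ n) / suc m) ((+ suc m) / suc (m + n)) (toℚᵘ-injective (ℚᵘ.≃-trans
  (toℚᵘ-*-≃ (toℚᵘ-+-≃ ℚᵘ.≃-refl (toℚᵘ-/ n m)) (toℚᵘ-/ (suc m) (m + n)))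
  (*≡* (solve 2 (λ x y → ((con (+ 1) :* x :+ y :* con (+ 1)) :* x) :* con (+ 1)
                         := con (+ 1) :* ((con (+ 1) :* x) :* (x :+ y)))
              refl (+ suc m) (+ n)))))

g-/ : ∀ m n → g ((+ n) / suc m) ≡ (+ (2 * suc m)) / suc (m + n)
g-/ m n = trans (cong ((+ 2 / 1) *ℚ_) (inv-1+/ m n)) (/1-*-/ 2 (suc m) (m + n))

A_g-via-recSum : ∀ c M → A_g c M +ℚ ((+ (2 * suc M)) / suc (2 * suc M)) *ℚ c (suc M)
                     ≡ ((+ (2 * suc M)) / 1) *ℚ recSum c (suc M)
A_g-via-recSum c M = begin
  A_g c M +ℚ w *ℚ c N                       ≡⟨ cong₂ _+ℚ_ (sumTo-cong N summand) last ⟩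
  sumTo N (λ k → s *ℚ f k) +ℚ s *ℚ f N      ≡⟨ cong (_+ℚ s *ℚ f N) (sumTo-*ˡ N s f) ⟩
  s *ℚ sumTo N f +ℚ s *ℚ f N                ≡⟨ *-distribˡ-+ s (sumTo N f) (f N) ⟨
  s *ℚ recSum c N                           ∎
  where
  N = suc M
  s = (+ (2 * N)) / 1
  w = (+ (2 * N)) / suc (2 * N)

  f : ℕ → ℚ
  f k = c k *ℚ ((+ 1) / suc (N + k))

  summand : ∀ i → aSeq c (suc i) *ℚ g ((+ suc i) / N) ≡ s *ℚ f i
  summand i = begin
    c i *ℚ g ((+ suc i) / N)                 ≡⟨ cong (c i *ℚ_) (g-/ M (suc i)) ⟩
    c i *ℚ ((+ (2 * N)) / suc (M + suc i))   ≡⟨ cong (λ d → c i *ℚ ((+ (2 * N)) / suc d)) (ℕₚ.+-suc M i) ⟩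
    c i *ℚ ((+ (2 * N)) / suc (N + i))       ≡⟨ cong (c i *ℚ_) (/-split (2 * N) (N + i)) ⟩
    c i *ℚ (s *ℚ ((+ 1) / suc (N + i)))      ≡⟨ x∙yz≈y∙xz (c i) s ((+ 1) / suc (N + i)) ⟩
    s *ℚ f i                                 ∎

  last : w *ℚ c N ≡ s *ℚ f N
  last = begin
    w *ℚ c N                                 ≡⟨ cong (_*ℚ c N) (/-split (2 * N) (2 * N)) ⟩
    (s *ℚ ((+ 1) / suc (2 * N))) *ℚ c N      ≡⟨ xy∙z≈x∙zy s ((+ 1) / suc (2 * N)) (c N) ⟩
    s *ℚ (c N *ℚ ((+ 1) / suc (2 * N)))      ≡⟨ cong (λ d → s *ℚ (c N *ℚ ((+ 1) / suc (N + d)))) (ℕₚ.+-identityʳ N) ⟩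
    s *ℚ f N                                 ∎

A_g-closed-form : ∀ c M → recSum c (suc M) ≡ 0ℚ →
                  A_g c M ≡ - ((+ (2 * suc M)) / suc (2 * suc M)) *ℚ c (suc M)
A_g-closed-form c M recSum≡0 = begin
  A_g c M        ≡⟨ inverseˡ-unique (A_g c M) (w *ℚ c N) A_g+w*c≡0 ⟩
  - (w *ℚ c N)   ≡⟨ neg-distribˡ-* w (c N) ⟩
  - w *ℚ c N     ∎
  where
  N = suc M
  s = (+ (2 * N)) / 1
  w = (+ (2 * N)) / suc (2 * N)

  A_g+w*c≡0 : A_g c M +ℚ w *ℚ c N ≡ 0ℚ
  A_g+w*c≡0 = begin
    A_g c M +ℚ w *ℚ c N   ≡⟨ A_g-via-recSum c M ⟩
    s *ℚ recSum c N       ≡⟨ cong (s *ℚ_) recSum≡0 ⟩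
    s *ℚ 0ℚ               ≡⟨ *-zeroʳ s ⟩
    0ℚ                    ∎

lemma4p1 : (c : ℕ → ℚ) → c 0 ≡ 1ℚ → ((N : ℕ) → N ≥ 1 → recSum c N ≡ 0ℚ) →
    (N : ℕ) → (N≥2 : N ≥ 2) →
      A_g c (N ∸ 1) ≡ - ((+ (2 * N)) / suc (2 * N)) *ℚ aSeq c (suc N)
lemma4p1 c _ recurrence (suc M) (s≤s _) = A_g-closed-form c M (recurrence (suc M) (s≤s z≤n))
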